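{- Let $G=(V,E)$ be a hypergraph and $e\in E$ an edge with $|e|>1$. If no edge of $E$ other than (this occurrence of) $e$ is a subset of $e$, then \[ I(G,x)=I(G_{ -e},x)-x^{|e|}\cdot I\bigl((G_{ -e})_{\div e},x\bigr); \] otherwise $I(G,x)=I(G_{ -e},x)$.
   Context: A hypergraph $G=(V,E)$ consists of a finite vertex set $V$ and a finite multiset $E$ of non-empty subsets of $V$ (edges). A set $W\subseteq V$ is independent in $G$ if no edge $f\in E$ satisfies $f\subseteq W$. The independence polynomial is $I(G,x)=\sum_{W\subseteq V,\ W\text{ independent}}x^{|W|}$. $G_{ -e}$ is obtained by removing the edge $e$ (one occurrence) from $E$. For a hypergraph $H$ and a set $S$ of its vertices containing no edge of $H$, $H_{\div S}$ ("hiding" $S$) is the hypergraph with vertex set $V(H)\setminus S$ and edge multiset $\{f\setminus S: f\in E(H)\}$. -}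

module Defs where

open import Level using (Level)
open import Data.Nat using (ℕ; zero; suc)
open import Data.Bool using (Bool)
open import Data.Product using (_×_; _,_)
open import Data.List using (List; []; _∷_; _++_; map; filter; foldr)
open import Data.List.Relation.Unary.All using (All; all?)
open import Data.Vec using (_∷_; [])
open import Data.Fin.Subset using (Subset; _⊆_; _─_; ∣_∣; inside; outside)
open import Data.Fin.Subset.Properties using (_⊆?_)
open import Relation.Nullary using (¬_; Dec; ¬?)
open import Relation.Nullary.Decidable using (_×-dec_)
open import Algebra.Bundles using (CommutativeRing)

-- Hypergraphs on the ambient type Fin n: a vertex set V : Subset n together
-- with a list (= multiset) E of edges, each edge a Subset n.
-- (Well-formedness "every edge is a non-empty subset of V" is imposed as a
-- hypothesis where needed.)

allSubsets : (n : ℕ) → List (Subset n)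
allSubsets zero    = [] ∷ []
allSubsets (suc n) = map (inside ∷_) (allSubsets n) ++ map (outside ∷_) (allSubsets n)

Independent : ∀ {n} → List (Subset n) → Subset n → Set
Independent E W = All (λ f → ¬ (f ⊆ W)) E

independent? : ∀ {n} (E : List (Subset n)) (W : Subset n) → Dec (Independent E W)
independent? E W = all? (λ f → ¬? (f ⊆? W)) E

independentSets : ∀ {n} → Subset n → List (Subset n) → List (Subset n)
independentSets {n} V E = filter (λ W → (W ⊆? V) ×-dec independent? E W) (allSubsets n)

hideV : ∀ {n} → Subset n → Subset n → Subset n
hideV V S = V ─ S

hideE : ∀ {n} → List (Subset n) → Subset n → List (Subset n)
hideE E S = map (λ f → f ─ S) E

module _ {c ℓ : Level} (R : CommutativeRing c ℓ) where
  open CommutativeRing R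

  pow : Carrier → ℕ → Carrier
  pow x zero    = 1#
  pow x (suc k) = x * pow x k

  indepPoly : ∀ {n} → Subset n → List (Subset n) → Carrier → Carrier
  indepPoly V E x = foldr (λ W acc → pow x ∣ W ∣ + acc) 0# (independentSets V E)

-- Write I(G, x) as the sum, over all W ⊆ Fin n, of [W ⊆ V][W independent] x^|W|.
-- Adding the edge e to G₋ₑ kills exactly the terms with e ⊆ W, so I(G₋ₑ) − I(G)
-- is the sum of the terms of G₋ₑ over the supersets W of e.  As e ⊆ V, writing
-- W = U ∪ e with U disjoint from e turns this into x^|e| times the sum over the
-- U ⊆ V ∖ e independent in (G₋ₑ)÷e, because f ⊆ U ∪ e iff f ∖ e ⊆ U.  If another
-- edge lies inside e, no superset of e is independent in G₋ₑ and the sum is 0.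
module Submission where

open import Defs
open import Level using (Level)
open import Data.Nat using (ℕ; zero; suc; _<_)
import Data.Nat as ℕ
open import Data.Nat.Properties using (+-suc)
open import Data.Product using (_×_; _,_)
open import Data.List using (List; []; _∷_; _++_; map; foldr; filter)
open import Data.List.Relation.Unary.All using (All; head)
open import Data.List.Relation.Unary.All.Properties using (++⁻ʳ; All¬⇒¬Any)
open import Data.List.Relation.Unary.Any as Any using (Any)
open import Data.Fin.Subset using (Subset; _⊆_; ∣_∣; Nonempty; inside; outside; _∪_; _─_)
open import Data.Fin.Subset.Properties using (_⊆?_; ⊆-trans)
open import Data.Vec using ([]; _∷_)
open import Data.Bool using (Bool; true; false; not; _∧_)
open import Data.Bool.Properties using (∧-zeroʳ; ∧-commutativeMonoid)
open import Relation.Nullary using (¬_; does; _because_)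
open import Relation.Nullary.Reflects using (invert)
open import Relation.Nullary.Decidable using (dec-true; dec-false; _×-dec_)
open import Relation.Unary using (Decidable)
open import Relation.Binary.PropositionalEquality using (_≡_; refl; cong; sym; trans)
open import Algebra.Bundles using (CommutativeRing; CommutativeMonoid)
import Algebra.Properties.CommutativeSemigroup as CommSemigroupProperties

open CommSemigroupProperties (CommutativeMonoid.commutativeSemigroup ∧-commutativeMonoid)
  using () renaming (x∙yz≈y∙xz to ∧-swapˡ)

private
  variable
    n : ℕ

_⊆ᵇ_ : Subset n → Subset n → Bool
p ⊆ᵇ q = does (p ⊆? q)

independentᵇ : List (Subset n) → Subset n → Bool
independentᵇ E W = does (independent? E W)

disjointᵇ : Subset n → Subset n → Bool
disjointᵇ []         []         = true
disjointᵇ (true ∷ p)  (true ∷ q)  = false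
disjointᵇ (true ∷ p)  (false ∷ q) = disjointᵇ p q
disjointᵇ (false ∷ p) (_ ∷ q)     = disjointᵇ p q

f⊆ᵇU∪e≡f─e⊆ᵇU : (f U e : Subset n) → f ⊆ᵇ (U ∪ e) ≡ (f ─ e) ⊆ᵇ U
f⊆ᵇU∪e≡f─e⊆ᵇU []          []          []          = refl
f⊆ᵇU∪e≡f─e⊆ᵇU (false ∷ f) (_ ∷ U)     (true ∷ e)  = f⊆ᵇU∪e≡f─e⊆ᵇU f U e
f⊆ᵇU∪e≡f─e⊆ᵇU (false ∷ f) (_ ∷ U)     (false ∷ e) = f⊆ᵇU∪e≡f─e⊆ᵇU f U e
f⊆ᵇU∪e≡f─e⊆ᵇU (true ∷ f)  (true ∷ U)  (true ∷ e)  = f⊆ᵇU∪e≡f─e⊆ᵇU f U e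
f⊆ᵇU∪e≡f─e⊆ᵇU (true ∷ f)  (false ∷ U) (true ∷ e)  = f⊆ᵇU∪e≡f─e⊆ᵇU f U e
f⊆ᵇU∪e≡f─e⊆ᵇU (true ∷ f)  (true ∷ U)  (false ∷ e) = f⊆ᵇU∪e≡f─e⊆ᵇU f U e
f⊆ᵇU∪e≡f─e⊆ᵇU (true ∷ f)  (false ∷ U) (false ∷ e) = refl

U∪e⊆ᵇV≡U⊆ᵇV∧e⊆ᵇV : (U e V : Subset n) → (U ∪ e) ⊆ᵇ V ≡ U ⊆ᵇ V ∧ e ⊆ᵇ V
U∪e⊆ᵇV≡U⊆ᵇV∧e⊆ᵇV []          []          []          = refl
U∪e⊆ᵇV≡U⊆ᵇV∧e⊆ᵇV (true ∷ U)  (true ∷ e)  (true ∷ V)  = U∪e⊆ᵇV≡U⊆ᵇV∧e⊆ᵇV U e V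
U∪e⊆ᵇV≡U⊆ᵇV∧e⊆ᵇV (true ∷ U)  (false ∷ e) (true ∷ V)  = U∪e⊆ᵇV≡U⊆ᵇV∧e⊆ᵇV U e V
U∪e⊆ᵇV≡U⊆ᵇV∧e⊆ᵇV (true ∷ U)  (_ ∷ e)     (false ∷ V) = refl
U∪e⊆ᵇV≡U⊆ᵇV∧e⊆ᵇV (false ∷ U) (true ∷ e)  (true ∷ V)  = U∪e⊆ᵇV≡U⊆ᵇV∧e⊆ᵇV U e V
U∪e⊆ᵇV≡U⊆ᵇV∧e⊆ᵇV (false ∷ U) (true ∷ e)  (false ∷ V) = sym (∧-zeroʳ (U ⊆ᵇ V))
U∪e⊆ᵇV≡U⊆ᵇV∧e⊆ᵇV (false ∷ U) (false ∷ e) (_ ∷ V)     = U∪e⊆ᵇV≡U⊆ᵇV∧e⊆ᵇV U e V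

U⊆ᵇV─e≡U⊆ᵇV∧disjoint : (U V e : Subset n) → U ⊆ᵇ (V ─ e) ≡ U ⊆ᵇ V ∧ disjointᵇ U e
U⊆ᵇV─e≡U⊆ᵇV∧disjoint []          []          []          = refl
U⊆ᵇV─e≡U⊆ᵇV∧disjoint (false ∷ U) (_ ∷ V)     (true ∷ e)  = U⊆ᵇV─e≡U⊆ᵇV∧disjoint U V e
U⊆ᵇV─e≡U⊆ᵇV∧disjoint (false ∷ U) (_ ∷ V)     (false ∷ e) = U⊆ᵇV─e≡U⊆ᵇV∧disjoint U V e
U⊆ᵇV─e≡U⊆ᵇV∧disjoint (true ∷ U)  (v ∷ V)     (true ∷ e)  = sym (∧-zeroʳ ((true ∷ U) ⊆ᵇ (v ∷ V)))
U⊆ᵇV─e≡U⊆ᵇV∧disjoint (true ∷ U)  (true ∷ V)  (false ∷ e) = U⊆ᵇV─e≡U⊆ᵇV∧disjoint U V e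
U⊆ᵇV─e≡U⊆ᵇV∧disjoint (true ∷ U)  (false ∷ V) (false ∷ e) = refl

∣U∪e∣≡∣U∣+∣e∣ : (U e : Subset n) → disjointᵇ U e ≡ true → ∣ U ∪ e ∣ ≡ ∣ U ∣ ℕ.+ ∣ e ∣
∣U∪e∣≡∣U∣+∣e∣ []          []          _  = refl
∣U∪e∣≡∣U∣+∣e∣ (true ∷ U)  (false ∷ e) U#e = cong suc (∣U∪e∣≡∣U∣+∣e∣ U e U#e)
∣U∪e∣≡∣U∣+∣e∣ (false ∷ U) (true ∷ e)  U#e =
  trans (cong suc (∣U∪e∣≡∣U∣+∣e∣ U e U#e)) (sym (+-suc ∣ U ∣ ∣ e ∣))
∣U∪e∣≡∣U∣+∣e∣ (false ∷ U) (false ∷ e) U#e = ∣U∪e∣≡∣U∣+∣e∣ U e U#e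

independentᵇ-++-∷ : (E₁ E₂ : List (Subset n)) (e W : Subset n) →
  independentᵇ (E₁ ++ e ∷ E₂) W ≡ not (e ⊆ᵇ W) ∧ independentᵇ (E₁ ++ E₂) W
independentᵇ-++-∷ []       E₂ e W = refl
independentᵇ-++-∷ (f ∷ E₁) E₂ e W = trans
  (cong (not (f ⊆ᵇ W) ∧_) (independentᵇ-++-∷ E₁ E₂ e W))
  (∧-swapˡ (not (f ⊆ᵇ W)) (not (e ⊆ᵇ W)) (independentᵇ (E₁ ++ E₂) W))

independentᵇ-hideE : (E : List (Subset n)) (e U : Subset n) →
  independentᵇ (hideE E e) U ≡ independentᵇ E (U ∪ e)
independentᵇ-hideE []      e U = refl
independentᵇ-hideE (f ∷ E) e U
  rewrite independentᵇ-hideE E e U | f⊆ᵇU∪e≡f─e⊆ᵇU f U e = refl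

¬Independent-⊇ : {E : List (Subset n)} {e W : Subset n} →
  Any (_⊆ e) E → e ⊆ W → ¬ Independent E W
¬Independent-⊇ {e = e} {W} f⊆e e⊆W independent =
  All¬⇒¬Any independent (Any.map {P = _⊆ e} {Q = _⊆ W} (λ f⊆e → ⊆-trans f⊆e e⊆W) f⊆e)

module _ {c ℓ : Level} (R : CommutativeRing c ℓ) where
  open CommutativeRing R renaming (refl to ≈-refl; sym to ≈-sym; trans to ≈-trans)
  open CommSemigroupProperties +-commutativeSemigroup using () renaming (interchange to +-interchange)
  open import Relation.Binary.Reasoning.Setoid setoid

  χ : Bool → Carrier
  χ true  = 1#
  χ false = 0#

  ∑ : ∀ n → (Subset n → Carrier) → Carrier
  ∑ zero    g = g []
  ∑ (suc n) g = ∑ n (λ W → g (inside ∷ W)) + ∑ n (λ W → g (outside ∷ W))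

  ∑-cong : ∀ n {g h : Subset n → Carrier} → (∀ W → g W ≈ h W) → ∑ n g ≈ ∑ n h
  ∑-cong zero    g≈h = g≈h []
  ∑-cong (suc n) g≈h = +-cong (∑-cong n (λ W → g≈h (inside ∷ W))) (∑-cong n (λ W → g≈h (outside ∷ W)))

  ∑-+ : ∀ n (g h : Subset n → Carrier) → ∑ n (λ W → g W + h W) ≈ ∑ n g + ∑ n h
  ∑-+ zero    g h = ≈-refl
  ∑-+ (suc n) g h = ≈-trans (+-cong (∑-+ n _ _) (∑-+ n _ _)) (+-interchange _ _ _ _)

  ∑-*ˡ : ∀ n a (g : Subset n → Carrier) → ∑ n (λ W → a * g W) ≈ a * ∑ n g
  ∑-*ˡ zero    a g = ≈-refl
  ∑-*ˡ (suc n) a g = ≈-trans (+-cong (∑-*ˡ n a _) (∑-*ˡ n a _)) (≈-sym (distribˡ a _ _))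

  ∑-zeroˡ : ∀ n (g : Subset n → Carrier) → ∑ n (λ W → 0# * g W) ≈ 0#
  ∑-zeroˡ n g = ≈-trans (∑-*ˡ n 0# g) (zeroˡ _)

  ∑-supersets : ∀ n (e : Subset n) (g : Subset n → Carrier) →
    ∑ n (λ W → χ (e ⊆ᵇ W) * g W) ≈ ∑ n (λ U → χ (disjointᵇ U e) * g (U ∪ e))
  ∑-supersets zero    []          g = ≈-refl
  ∑-supersets (suc n) (false ∷ e) g = +-cong (∑-supersets n e _) (∑-supersets n e _)
  ∑-supersets (suc n) (true ∷ e)  g = begin
      ∑ n (λ W → χ (e ⊆ᵇ W) * g (inside ∷ W)) + ∑ n (λ W → 0# * g (outside ∷ W))
    ≈⟨ +-congˡ (∑-zeroˡ n _) ⟩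
      ∑ n (λ W → χ (e ⊆ᵇ W) * g (inside ∷ W)) + 0#
    ≈⟨ +-comm _ _ ⟩
      0# + ∑ n (λ W → χ (e ⊆ᵇ W) * g (inside ∷ W))
    ≈⟨ +-cong (≈-sym (∑-zeroˡ n _)) (∑-supersets n e _) ⟩
      ∑ n (λ U → 0# * g (inside ∷ (U ∪ e))) + ∑ n (λ U → χ (disjointᵇ U e) * g (inside ∷ (U ∪ e))) ∎

  listSum : (Subset n → Carrier) → List (Subset n) → Carrier
  listSum g = foldr (λ W acc → g W + acc) 0#

  listSum-++ : (g : Subset n → Carrier) (Ws Ws′ : List (Subset n)) →
    listSum g (Ws ++ Ws′) ≈ listSum g Ws + listSum g Ws′
  listSum-++ g []       Ws′ = ≈-sym (+-identityˡ _)
  listSum-++ g (W ∷ Ws) Ws′ = ≈-trans (+-congˡ (listSum-++ g Ws Ws′)) (≈-sym (+-assoc _ _ _))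

  listSum-map : ∀ {m} (g : Subset n → Carrier) (h : Subset m → Subset n) (Ws : List (Subset m)) →
    listSum g (map h Ws) ≈ listSum (λ W → g (h W)) Ws
  listSum-map g h []       = ≈-refl
  listSum-map g h (W ∷ Ws) = +-congˡ (listSum-map g h Ws)

  listSum-allSubsets : ∀ n (g : Subset n → Carrier) → listSum g (allSubsets n) ≈ ∑ n g
  listSum-allSubsets zero    g = +-identityʳ _
  listSum-allSubsets (suc n) g = ≈-trans
    (listSum-++ g (map (inside ∷_) (allSubsets n)) (map (outside ∷_) (allSubsets n)))
    (+-cong (≈-trans (listSum-map g _ (allSubsets n)) (listSum-allSubsets n _))
            (≈-trans (listSum-map g _ (allSubsets n)) (listSum-allSubsets n _)))

  listSum-filter : ∀ {p} {P : Subset n → Set p} (P? : Decidable P) (g : Subset n → Carrier) Ws →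
    listSum g (filter P? Ws) ≈ listSum (λ W → χ (does (P? W)) * g W) Ws
  listSum-filter P? g [] = ≈-refl
  listSum-filter P? g (W ∷ Ws) with does (P? W)
  ... | true  = +-cong (≈-sym (*-identityˡ _)) (listSum-filter P? g Ws)
  ... | false = ≈-trans (listSum-filter P? g Ws) (≈-sym (≈-trans (+-congʳ (zeroˡ _)) (+-identityˡ _)))

  pow-+ : ∀ x i j → pow R x (i ℕ.+ j) ≈ pow R x i * pow R x j
  pow-+ x zero    j = ≈-sym (*-identityˡ _)
  pow-+ x (suc i) j = ≈-trans (*-congˡ (pow-+ x i j)) (≈-sym (*-assoc _ _ _))

  term : Subset n → List (Subset n) → Carrier → Subset n → Carrier
  term V E x W = χ (W ⊆ᵇ V ∧ independentᵇ E W) * pow R x ∣ W ∣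

  indepPoly≈∑term : (V : Subset n) (E : List (Subset n)) (x : Carrier) →
    indepPoly R V E x ≈ ∑ n (term V E x)
  indepPoly≈∑term {n} V E x = ≈-trans
    (listSum-filter (λ W → (W ⊆? V) ×-dec independent? E W) _ (allSubsets n))
    (listSum-allSubsets n _)

  χ-∧-split : ∀ a b c → χ (a ∧ b) ≈ χ (a ∧ (not c ∧ b)) + χ c * χ (a ∧ b)
  χ-∧-split true  true  true  = ≈-sym (≈-trans (+-identityˡ _) (*-identityˡ _))
  χ-∧-split true  true  false = ≈-sym (≈-trans (+-congˡ (zeroˡ _)) (+-identityʳ _))
  χ-∧-split true  false true  = ≈-sym (≈-trans (+-identityˡ _) (zeroʳ _))
  χ-∧-split true  false false = ≈-sym (≈-trans (+-identityˡ _) (zeroʳ _))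
  χ-∧-split false _     _     = ≈-sym (≈-trans (+-identityˡ _) (zeroʳ _))

  indepPoly-deleteEdge : (V : Subset n) (E₁ E₂ : List (Subset n)) (e : Subset n) (x : Carrier) →
    indepPoly R V (E₁ ++ E₂) x
      ≈ indepPoly R V (E₁ ++ e ∷ E₂) x + ∑ n (λ W → χ (e ⊆ᵇ W) * term V (E₁ ++ E₂) x W)
  indepPoly-deleteEdge {n} V E₁ E₂ e x = begin
      indepPoly R V (E₁ ++ E₂) x
    ≈⟨ indepPoly≈∑term V (E₁ ++ E₂) x ⟩
      ∑ n (term V (E₁ ++ E₂) x)
    ≈⟨ ∑-cong n split ⟩
      ∑ n (λ W → term V (E₁ ++ e ∷ E₂) x W + χ (e ⊆ᵇ W) * term V (E₁ ++ E₂) x W)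
    ≈⟨ ∑-+ n _ _ ⟩
      ∑ n (term V (E₁ ++ e ∷ E₂) x) + ∑ n (λ W → χ (e ⊆ᵇ W) * term V (E₁ ++ E₂) x W)
    ≈⟨ +-congʳ (≈-sym (indepPoly≈∑term V (E₁ ++ e ∷ E₂) x)) ⟩
      indepPoly R V (E₁ ++ e ∷ E₂) x + ∑ n (λ W → χ (e ⊆ᵇ W) * term V (E₁ ++ E₂) x W) ∎
    where
    split : ∀ W → term V (E₁ ++ E₂) x W
                    ≈ term V (E₁ ++ e ∷ E₂) x W + χ (e ⊆ᵇ W) * term V (E₁ ++ E₂) x W
    split W rewrite independentᵇ-++-∷ E₁ E₂ e W = ≈-trans
      (*-congʳ (χ-∧-split (W ⊆ᵇ V) (independentᵇ (E₁ ++ E₂) W) (e ⊆ᵇ W)))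
      (≈-trans (distribʳ _ _ _) (+-congˡ (*-assoc _ _ _)))

  supersetTerm≈hiddenTerm : (V : Subset n) (E : List (Subset n)) (e : Subset n) (x : Carrier) →
    e ⊆ᵇ V ≡ true → ∀ U →
    χ (disjointᵇ U e) * term V E x (U ∪ e) ≈ pow R x ∣ e ∣ * term (V ─ e) (hideE E e) x U
  supersetTerm≈hiddenTerm V E e x e⊆V U
    rewrite U∪e⊆ᵇV≡U⊆ᵇV∧e⊆ᵇV U e V | U⊆ᵇV─e≡U⊆ᵇV∧disjoint U V e | independentᵇ-hideE E e U | e⊆V
    with disjointᵇ U e in U#e
  ... | false rewrite ∧-zeroʳ (U ⊆ᵇ V) =
    ≈-trans (zeroˡ _) (≈-sym (≈-trans (*-congˡ (zeroˡ _)) (zeroʳ _)))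
  ... | true = begin
      1# * (k * pow R x ∣ U ∪ e ∣)
    ≈⟨ *-identityˡ _ ⟩
      k * pow R x ∣ U ∪ e ∣
    ≈⟨ *-congˡ (reflexive (cong (pow R x) (∣U∪e∣≡∣U∣+∣e∣ U e U#e))) ⟩
      k * pow R x (∣ U ∣ ℕ.+ ∣ e ∣)
    ≈⟨ *-congˡ (pow-+ x ∣ U ∣ ∣ e ∣) ⟩
      k * (pow R x ∣ U ∣ * pow R x ∣ e ∣)
    ≈⟨ ≈-sym (*-assoc _ _ _) ⟩
      (k * pow R x ∣ U ∣) * pow R x ∣ e ∣
    ≈⟨ *-comm _ _ ⟩
      pow R x ∣ e ∣ * (k * pow R x ∣ U ∣) ∎
    where
    k : Carrier
    k = χ ((U ⊆ᵇ V ∧ true) ∧ independentᵇ E (U ∪ e))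

  ∑-supersetTerms≈hidden : (V : Subset n) (E : List (Subset n)) (e : Subset n) (x : Carrier) →
    e ⊆ V →
    ∑ n (λ W → χ (e ⊆ᵇ W) * term V E x W) ≈ pow R x ∣ e ∣ * indepPoly R (hideV V e) (hideE E e) x
  ∑-supersetTerms≈hidden {n} V E e x e⊆V = begin
      ∑ n (λ W → χ (e ⊆ᵇ W) * term V E x W)
    ≈⟨ ∑-supersets n e _ ⟩
      ∑ n (λ U → χ (disjointᵇ U e) * term V E x (U ∪ e))
    ≈⟨ ∑-cong n (supersetTerm≈hiddenTerm V E e x (dec-true (e ⊆? V) e⊆V)) ⟩
      ∑ n (λ U → pow R x ∣ e ∣ * term (V ─ e) (hideE E e) x U)
    ≈⟨ ∑-*ˡ n _ _ ⟩
      pow R x ∣ e ∣ * ∑ n (term (V ─ e) (hideE E e) x)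
    ≈⟨ *-congˡ (≈-sym (indepPoly≈∑term (V ─ e) (hideE E e) x)) ⟩
      pow R x ∣ e ∣ * indepPoly R (hideV V e) (hideE E e) x ∎

  ∑-supersetTerms≈0 : (V : Subset n) (E : List (Subset n)) (e : Subset n) (x : Carrier) →
    Any (_⊆ e) E → ∑ n (λ W → χ (e ⊆ᵇ W) * term V E x W) ≈ 0#
  ∑-supersetTerms≈0 {n} V E e x f⊆e =
    ≈-trans (∑-cong n vanish) (∑-zeroˡ n (λ _ → 0#))
    where
    vanish : ∀ W → χ (e ⊆ᵇ W) * term V E x W ≈ 0# * 0#
    vanish W with e ⊆? W
    ... | false because _ = ≈-trans (zeroˡ _) (≈-sym (zeroˡ _))
    ... | true because [e⊆W]
      rewrite dec-false (independent? E W) (¬Independent-⊇ f⊆e (invert [e⊆W])) | ∧-zeroʳ (W ⊆ᵇ V) =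
      ≈-trans (*-identityˡ _) (≈-trans (zeroˡ _) (≈-sym (zeroˡ _)))

  x+z≈y⇒x≈y-z : ∀ {x y} z → x + z ≈ y → x ≈ y - z
  x+z≈y⇒x≈y-z {x} {y} z x+z≈y = begin
      x             ≈⟨ ≈-sym (+-identityʳ x) ⟩
      x + 0#        ≈⟨ +-congˡ (≈-sym (-‿inverseʳ z)) ⟩
      x + (z - z)   ≈⟨ ≈-sym (+-assoc _ _ _) ⟩
      (x + z) - z   ≈⟨ +-congʳ x+z≈y ⟩
      y - z         ∎

  indepPoly-deletion-contraction : (V : Subset n) (E₁ E₂ : List (Subset n)) (e : Subset n) (x : Carrier) →
    e ⊆ V →
    indepPoly R V (E₁ ++ e ∷ E₂) x
      ≈ indepPoly R V (E₁ ++ E₂) x - pow R x ∣ e ∣ * indepPoly R (hideV V e) (hideE (E₁ ++ E₂) e) x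
  indepPoly-deletion-contraction {n} V E₁ E₂ e x e⊆V = x+z≈y⇒x≈y-z _ (begin
      indepPoly R V (E₁ ++ e ∷ E₂) x + pow R x ∣ e ∣ * indepPoly R (hideV V e) (hideE (E₁ ++ E₂) e) x
    ≈⟨ +-congˡ (≈-sym (∑-supersetTerms≈hidden V (E₁ ++ E₂) e x e⊆V)) ⟩
      indepPoly R V (E₁ ++ e ∷ E₂) x + ∑ n (λ W → χ (e ⊆ᵇ W) * term V (E₁ ++ E₂) x W)
    ≈⟨ ≈-sym (indepPoly-deleteEdge V E₁ E₂ e x) ⟩
      indepPoly R V (E₁ ++ E₂) x ∎)

  indepPoly-redundantEdge : (V : Subset n) (E₁ E₂ : List (Subset n)) (e : Subset n) (x : Carrier) →
    Any (_⊆ e) (E₁ ++ E₂) → indepPoly R V (E₁ ++ e ∷ E₂) x ≈ indepPoly R V (E₁ ++ E₂) x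
  indepPoly-redundantEdge {n} V E₁ E₂ e x f⊆e = begin
      indepPoly R V (E₁ ++ e ∷ E₂) x
    ≈⟨ ≈-sym (+-identityʳ _) ⟩
      indepPoly R V (E₁ ++ e ∷ E₂) x + 0#
    ≈⟨ +-congˡ (≈-sym (∑-supersetTerms≈0 V (E₁ ++ E₂) e x f⊆e)) ⟩
      indepPoly R V (E₁ ++ e ∷ E₂) x + ∑ n (λ W → χ (e ⊆ᵇ W) * term V (E₁ ++ E₂) x W)
    ≈⟨ ≈-sym (indepPoly-deleteEdge V E₁ E₂ e x) ⟩
      indepPoly R V (E₁ ++ E₂) x ∎

-- Only e ⊆ V is used: the first identity holds for every edge e, and under the
-- second case's hypothesis its correction term is 0 (some f ∖ e is empty).
mainTheorem6 : ∀ {c ℓ : Level} (R : CommutativeRing c ℓ) (n : ℕ)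
    (V : Subset n) (E₁ E₂ : List (Subset n)) (e : Subset n) →
    All (λ f → f ⊆ V) (E₁ ++ e ∷ E₂) →
    All Nonempty (E₁ ++ e ∷ E₂) →
    1 < ∣ e ∣ →
    (x : CommutativeRing.Carrier R) →
    (All (λ f → ¬ (f ⊆ e)) (E₁ ++ E₂) →
      CommutativeRing._≈_ R
        (indepPoly R V (E₁ ++ e ∷ E₂) x)
        (CommutativeRing._-_ R
          (indepPoly R V (E₁ ++ E₂) x)
          (CommutativeRing._*_ R (pow R x ∣ e ∣)
            (indepPoly R (hideV V e) (hideE (E₁ ++ E₂) e) x))))
    ×
    (Any (λ f → f ⊆ e) (E₁ ++ E₂) →
      CommutativeRing._≈_ R
        (indepPoly R V (E₁ ++ e ∷ E₂) x)
        (indepPoly R V (E₁ ++ E₂) x))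
mainTheorem6 R n V E₁ E₂ e edges⊆V _ _ x =
    (λ _ → indepPoly-deletion-contraction R V E₁ E₂ e x e⊆V)
  , indepPoly-redundantEdge R V E₁ E₂ e x
  where
  e⊆V : e ⊆ V
  e⊆V = head (++⁻ʳ E₁ edges⊆V)
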